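{- For any cubic graph $G$ of order $n$, $$\gamma_{\mathrm{sdR}}(G)\ \ge\ \begin{cases} n/2 & \text{if } n\equiv 0 \pmod 4,\\ n/2+1 & \text{if } n\equiv 2\pmod 4.\end{cases}$$
   Context: All graphs are finite, undirected and simple; a cubic graph is a 3-regular graph (so $n$ is even). $N(u)$ is the open neighborhood of $u$, $N[u]=N(u)\cup\{u\}$. For $f:V\to\{ -1,1,2,3\}$ write $V_i=f^{ -1}(i)$ and $f(S)=\sum_{s\in S}f(s)$. A signed double Roman domination function (SDRDF) is $f:V\to\{ -1,1,2,3\}$ such that: (1) every $u\in V_{ -1}$ has a neighbor in $V_3$ or at least two distinct neighbors in $V_2$; (2) every $u\in V_1$ has a neighbor in $V_2\cup V_3$; (3) $f(N[u])\ge 1$ for all $u\in V$. $\gamma_{\mathrm{sdR}}(G)$ is the minimum of $f(V)$ over all SDRDFs on $G$. -}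

module Defs where

open import Data.Nat using (ℕ)
open import Data.Bool using (Bool; true; false)
open import Data.Fin using (Fin)
open import Data.Integer using (ℤ; +_; -[1+_]; _+_; _≤_)
open import Data.List using (List; []; _∷_; map; length; filterᵇ; allFin)
open import Data.Product using (Σ; _×_; ∃)
open import Data.Sum using (_⊎_)
open import Relation.Binary.PropositionalEquality using (_≡_; _≢_)
open import Function using (_∘_)

record Graph (n : ℕ) : Set where
  field
    adj    : Fin n → Fin n → Bool
    sym    : ∀ u v → adj u v ≡ adj v u
    irrefl : ∀ u → adj u u ≡ false

open Graph public

nbrs : ∀ {n} → Graph n → Fin n → List (Fin n)
nbrs {n} G u = filterᵇ (adj G u) (allFin n)

degree : ∀ {n} → Graph n → Fin n → ℕ
degree G u = length (nbrs G u)

Cubic : ∀ {n} → Graph n → Set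
Cubic {n} G = ∀ (u : Fin n) → degree G u ≡ 3

sumℤ : List ℤ → ℤ
sumℤ []       = + 0
sumℤ (x ∷ xs) = x + sumℤ xs

data Label : Set where
  m1 one two three : Label

val : Label → ℤ
val m1    = -[1+ 0 ]
val one   = + 1
val two   = + 2
val three = + 3

closedSum : ∀ {n} → Graph n → (Fin n → Label) → Fin n → ℤ
closedSum G f u = val (f u) + sumℤ (map (val ∘ f) (nbrs G u))

weight : ∀ {n} → (Fin n → Label) → ℤ
weight {n} f = sumℤ (map (val ∘ f) (allFin n))

record IsSDRDF {n : ℕ} (G : Graph n) (f : Fin n → Label) : Set where
  field
    cond1 : ∀ u → f u ≡ m1 →
              (∃ λ v → adj G u v ≡ true × f v ≡ three)
              ⊎ (Σ (Fin n) λ v → Σ (Fin n) λ w → v ≢ w × adj G u v ≡ true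
                   × adj G u w ≡ true × f v ≡ two × f w ≡ two)
    cond2 : ∀ u → f u ≡ one → ∃ λ v → adj G u v ≡ true × (f v ≡ two ⊎ f v ≡ three)
    cond3 : ∀ u → + 1 ≤ closedSum G f u

-- Discharging. Give every vertex the charge 4 f(v) and let each vertex labelled 1, 2, 3 send
-- 1, 3, 5 to each neighbour labelled -1; the total charge stays 4 f(V). Let μ(v) indicate
-- f(v) = -1 and j(v) count the neighbours labelled -1. A check of all labelled stars of a cubic
-- graph shows that the SDRDF conditions force, at every vertex,
--   5 charge(v) + 4 μ(v) j(v) + j(v) ≥ 12 + 3 μ(v)   and   4 μ(v) j(v) + j(v) ≤ 2 + 3 μ(v).
-- Summing, Σ j = 3 |V₋₁| and Σ μ j = 2q, where q counts the edges inside V₋₁, so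
-- 20 f(V) + 8q ≥ 12n and 8q ≤ 2n. Together they give f(V) ≥ n/2, and if n = 4k + 2 then q ≤ k by
-- integrality, whence 20 f(V) ≥ 40k + 24 and f(V) ≥ 2k + 2.
module Submission where

open import Defs renaming (sym to adj-sym)
open import Data.Bool using (Bool; true; false; T; _∧_; _∨_; if_then_else_)
open import Data.Bool.ListAction using (any)
open import Data.Bool.Properties using (T?; T-≡; T-∧; T-∨)
open import Data.Empty using (⊥-elim)
open import Data.Fin using (Fin)
import Data.Fin.Properties as Fin
open import Data.Integer using (ℤ; +_; +[1+_]; 0ℤ; suc; +<+; +≤+; _+_; _-_; -_; _*_; _≤_; _<_; _≤?_; _≤ᵇ_)
import Data.Integer.Properties as ZP
open import Algebra.Properties.CommutativeSemigroup ZP.+-commutativeSemigroup using (interchange)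
open import Data.Integer.Tactic.RingSolver using (solve-∀)
open import Data.List using (List; []; _∷_; map; length; filterᵇ; allFin)
import Data.List.Properties as List
open import Data.List.Membership.Propositional using (_∈_; lose)
open import Data.List.Membership.Propositional.Properties using (∈-filter⁺; ∈-allFin)
open import Data.List.Relation.Unary.Any using (here; there)
open import Data.List.Relation.Unary.Any.Properties using (any⁺; map⁺)
open import Data.Nat as Nat using (ℕ; _/_; _%_)
open import Data.Nat.Divisibility using (divides)
open import Data.Nat.DivMod using (m≡m%n+[m/n]*n; m*n/n≡m; /-congˡ; +-distrib-/-∣ʳ)
import Data.Nat.Properties as ℕ
open import Data.Product using (_×_; _,_; ∃; proj₁; proj₂; uncurry)
open import Data.Sum using (_⊎_; inj₁; inj₂)
open import Function using (_∘_; Equivalence)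
open import Relation.Binary.PropositionalEquality
open import Relation.Nullary using (Dec; yes; no; ⌊_⌋; toWitness; _×-dec_; _→-dec_)

open Equivalence using (from)

+-cancelʳ-≤ : ∀ {i j} k → i + k ≤ j + k → i ≤ j
+-cancelʳ-≤ {i} {j} k i+k≤j+k = subst₂ _≤_ (cancel i k) (cancel j k) (ZP.+-monoˡ-≤ (- k) i+k≤j+k)
  where
  cancel : ∀ a b → a + b + - b ≡ a
  cancel = solve-∀

*-cancelˡ-≤-floor : ∀ c {x y : ℤ} → +[1+ c ] * x ≤ +[1+ c ] * y + + c → x ≤ y
*-cancelˡ-≤-floor c {x} {y} le =
  subst (x ≤_) (ZP.pred-suc y) (ZP.i<j⇒i≤pred[j] (ZP.*-cancelˡ-<-nonNeg +[1+ c ] lt))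
  where
  open ZP.≤-Reasoning
  lt : +[1+ c ] * x < +[1+ c ] * suc y
  lt = begin-strict
    +[1+ c ] * x             ≤⟨ le ⟩
    +[1+ c ] * y + + c       <⟨ ZP.+-monoʳ-< (+[1+ c ] * y) (+<+ (ℕ.n<1+n c)) ⟩
    +[1+ c ] * y + +[1+ c ]  ≡⟨ ZP.+-comm (+[1+ c ] * y) +[1+ c ] ⟩
    +[1+ c ] + +[1+ c ] * y  ≡⟨ ZP.*-suc +[1+ c ] y ⟨
    +[1+ c ] * suc y         ∎

module _ (k w Q : ℤ) where
  open ZP.≤-Reasoning

  bound-4k : + 12 * (+ 4 * k) ≤ + 20 * w + + 8 * Q → + 8 * Q ≤ + 2 * (+ 4 * k) → + 2 * k ≤ w
  bound-4k lower upper = ZP.*-cancelˡ-≤-pos (+ 2 * k) w (+ 20) (+-cancelʳ-≤ (+ 8 * k) (begin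
    + 20 * (+ 2 * k) + + 8 * k  ≡⟨ left k ⟩
    + 12 * (+ 4 * k)            ≤⟨ lower ⟩
    + 20 * w + + 8 * Q          ≤⟨ ZP.+-monoʳ-≤ (+ 20 * w) upper ⟩
    + 20 * w + + 2 * (+ 4 * k)  ≡⟨ right w k ⟩
    + 20 * w + + 8 * k          ∎))
    where
    left : ∀ k → + 20 * (+ 2 * k) + + 8 * k ≡ + 12 * (+ 4 * k)
    left = solve-∀
    right : ∀ w k → + 20 * w + + 2 * (+ 4 * k) ≡ + 20 * w + + 8 * k
    right = solve-∀

  bound-4k+2 : + 12 * (+ 4 * k + + 2) ≤ + 20 * w + + 8 * Q → + 8 * Q ≤ + 2 * (+ 4 * k + + 2) →
    + 2 * k + + 2 ≤ w
  bound-4k+2 lower upper = *-cancelˡ-≤-floor 19 (+-cancelʳ-≤ (+ 8 * k) (begin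
    + 20 * (+ 2 * k + + 2) + + 8 * k  ≡⟨ left k ⟩
    + 12 * (+ 4 * k + + 2) + + 16     ≤⟨ ZP.+-monoˡ-≤ (+ 16) lower ⟩
    + 20 * w + + 8 * Q + + 16         ≤⟨ ZP.+-monoˡ-≤ (+ 16) (ZP.+-monoʳ-≤ (+ 20 * w) (ZP.*-monoˡ-≤-nonNeg (+ 8) Q≤k)) ⟩
    + 20 * w + + 8 * k + + 16         ≤⟨ ZP.+-monoʳ-≤ (+ 20 * w + + 8 * k) (+≤+ (ℕ.m≤m+n 16 3)) ⟩
    + 20 * w + + 8 * k + + 19         ≡⟨ right w k ⟩
    + 20 * w + + 19 + + 8 * k         ∎))
    where
    left : ∀ k → + 20 * (+ 2 * k + + 2) + + 8 * k ≡ + 12 * (+ 4 * k + + 2) + + 16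
    left = solve-∀
    right : ∀ w k → + 20 * w + + 8 * k + + 19 ≡ + 20 * w + + 19 + + 8 * k
    right = solve-∀
    Q≤k : Q ≤ k
    Q≤k = *-cancelˡ-≤-floor 7 (begin
      + 8 * Q                  ≤⟨ upper ⟩
      + 2 * (+ 4 * k + + 2)    ≡⟨ double k ⟩
      + 8 * k + + 4            ≤⟨ ZP.+-monoʳ-≤ (+ 8 * k) (+≤+ (ℕ.m≤m+n 4 3)) ⟩
      + 8 * k + + 7            ∎)
      where
      double : ∀ k → + 2 * (+ 4 * k + + 2) ≡ + 8 * k + + 4
      double = solve-∀

n≡[n%4]+4[n/4] : ∀ n → n ≡ n % 4 Nat.+ 4 Nat.* (n / 4)
n≡[n%4]+4[n/4] n = trans (m≡m%n+[m/n]*n n 4) (cong (n % 4 Nat.+_) (ℕ.*-comm (n / 4) 4))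

n/2≡[n%4]/2+2[n/4] : ∀ n → n / 2 ≡ n % 4 / 2 Nat.+ 2 Nat.* (n / 4)
n/2≡[n%4]/2+2[n/4] n = begin
  n / 2                          ≡⟨ /-congˡ (n≡[n%4]+4[n/4] n) ⟩
  (n % 4 Nat.+ 4 Nat.* q) / 2    ≡⟨ +-distrib-/-∣ʳ (n % 4) (divides (2 Nat.* q) 4q≡2q*2) ⟩
  n % 4 / 2 Nat.+ 4 Nat.* q / 2  ≡⟨ cong (n % 4 / 2 Nat.+_) (trans (/-congˡ 4q≡2q*2) (m*n/n≡m (2 Nat.* q) 2)) ⟩
  n % 4 / 2 Nat.+ 2 Nat.* q      ∎
  where
  open ≡-Reasoning
  q = n / 4
  4q≡2q*2 : 4 Nat.* q ≡ 2 Nat.* q Nat.* 2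
  4q≡2q*2 = trans (ℕ.*-assoc 2 2 q) (ℕ.*-comm 2 (2 Nat.* q))

half-bound : ∀ n (w Q : ℤ) → + 12 * + n ≤ + 20 * w + + 8 * Q → + 8 * Q ≤ + 2 * + n →
  (n % 4 ≡ 0 → + (n / 2) ≤ w) × (n % 4 ≡ 2 → + (n / 2) + + 1 ≤ w)
half-bound n w Q lower upper = case-0 , case-2
  where
  k : ℤ
  k = + (n / 4)
  at : ∀ {m} → + n ≡ m → (+ 12 * m ≤ + 20 * w + + 8 * Q) × (+ 8 * Q ≤ + 2 * m)
  at refl = lower , upper
  +n≡ : ∀ {r} → n % 4 ≡ r → + n ≡ + r + + 4 * k
  +n≡ refl = trans (cong +_ (n≡[n%4]+4[n/4] n))
                   (trans (ZP.pos-+ (n % 4) _) (cong (λ z → + (n % 4) + z) (ZP.pos-* 4 (n / 4))))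
  +half≡ : ∀ {r} → n % 4 ≡ r → + (n / 2) ≡ + (r / 2) + + 2 * k
  +half≡ refl = trans (cong +_ (n/2≡[n%4]/2+2[n/4] n))
                      (trans (ZP.pos-+ (n % 4 / 2) _) (cong (λ z → + (n % 4 / 2) + z) (ZP.pos-* 2 (n / 4))))
  case-0 : n % 4 ≡ 0 → + (n / 2) ≤ w
  case-0 r≡0 = subst (_≤ w) (sym (trans (+half≡ r≡0) (ZP.+-identityˡ _)))
                     (uncurry (bound-4k k w Q) (at (trans (+n≡ r≡0) (ZP.+-identityˡ _))))
  case-2 : n % 4 ≡ 2 → + (n / 2) + + 1 ≤ w
  case-2 r≡2 = subst (_≤ w) (sym (trans (cong (_+ + 1) (+half≡ r≡2)) (regroup k)))
                     (uncurry (bound-4k+2 k w Q) (at (trans (+n≡ r≡2) (ZP.+-comm (+ 2) (+ 4 * k)))))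
    where
    regroup : ∀ k → + 1 + + 2 * k + + 1 ≡ + 2 * k + + 2
    regroup = solve-∀

∑ : {A : Set} → List A → (A → ℤ) → ℤ
∑ xs g = sumℤ (map g xs)

module _ {A : Set} where

  ∑-cong : ∀ (xs : List A) {g h : A → ℤ} → g ≗ h → ∑ xs g ≡ ∑ xs h
  ∑-cong []       g≗h = refl
  ∑-cong (x ∷ xs) g≗h = cong₂ _+_ (g≗h x) (∑-cong xs g≗h)

  ∑-+ : ∀ (xs : List A) (g h : A → ℤ) → ∑ xs (λ x → g x + h x) ≡ ∑ xs g + ∑ xs h
  ∑-+ []       g h = refl
  ∑-+ (x ∷ xs) g h rewrite ∑-+ xs g h = interchange (g x) (h x) (∑ xs g) (∑ xs h)

  ∑-* : ∀ (xs : List A) (c : ℤ) (g : A → ℤ) → ∑ xs (λ x → c * g x) ≡ c * ∑ xs g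
  ∑-* []       c g = sym (ZP.*-zeroʳ c)
  ∑-* (x ∷ xs) c g rewrite ∑-* xs c g = sym (ZP.*-distribˡ-+ c (g x) (∑ xs g))

  ∑-neg : ∀ (xs : List A) (g : A → ℤ) → ∑ xs (λ x → - g x) ≡ - ∑ xs g
  ∑-neg []       g = refl
  ∑-neg (x ∷ xs) g rewrite ∑-neg xs g = sym (ZP.neg-distrib-+ (g x) (∑ xs g))

  ∑-- : ∀ (xs : List A) (g h : A → ℤ) → ∑ xs (λ x → g x - h x) ≡ ∑ xs g - ∑ xs h
  ∑-- xs g h = trans (∑-+ xs g (-_ ∘ h)) (cong (λ s → ∑ xs g + s) (∑-neg xs h))

  ∑-const : ∀ (xs : List A) (c : ℤ) → ∑ xs (λ _ → c) ≡ c * + length xs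
  ∑-const []       c = sym (ZP.*-zeroʳ c)
  ∑-const (x ∷ xs) c rewrite ∑-const xs c = sym (ZP.*-suc c (+ length xs))

  ∑-mono-≤ : ∀ (xs : List A) {g h : A → ℤ} → (∀ x → g x ≤ h x) → ∑ xs g ≤ ∑ xs h
  ∑-mono-≤ []       g≤h = ZP.≤-refl
  ∑-mono-≤ (x ∷ xs) g≤h = ZP.+-mono-≤ (g≤h x) (∑-mono-≤ xs g≤h)

  ∑-filterᵇ : ∀ (p : A → Bool) (xs : List A) (g : A → ℤ) →
    ∑ (filterᵇ p xs) g ≡ ∑ xs (λ x → if p x then g x else 0ℤ)
  ∑-filterᵇ p []       g = refl
  ∑-filterᵇ p (x ∷ xs) g with p x
  ... | true  = cong (λ s → g x + s) (∑-filterᵇ p xs g)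
  ... | false = trans (∑-filterᵇ p xs g) (sym (ZP.+-identityˡ _))

  ∑-map : ∀ {B : Set} (f : B → A) (xs : List B) (g : A → ℤ) → ∑ (map f xs) g ≡ ∑ xs (g ∘ f)
  ∑-map f xs g = cong sumℤ (sym (List.map-∘ xs))

∑-comm : ∀ {A B : Set} (xs : List A) (ys : List B) (K : A → B → ℤ) →
  ∑ xs (λ x → ∑ ys (K x)) ≡ ∑ ys (λ y → ∑ xs (λ x → K x y))
∑-comm []       ys K = sym (trans (∑-const ys 0ℤ) (ZP.*-zeroˡ (+ length ys)))
∑-comm (x ∷ xs) ys K rewrite ∑-comm xs ys K = sym (∑-+ ys (K x) (λ y → ∑ xs (λ x′ → K x′ y)))

∑∑-even : ∀ {n} (A : Fin n → Fin n → ℤ) → (∀ u v → A u v ≡ A v u) → (∀ v → A v v ≡ 0ℤ) →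
  ∃ λ Q → ∑ (allFin n) (λ v → ∑ (allFin n) (A v)) ≡ + 2 * Q
∑∑-even {n} A A-sym A-diag = ∑∑ upper , (begin
    ∑∑ A                                               ≡⟨ ∑-cong V (λ v → ∑-cong V (split v)) ⟩
    ∑∑ (λ v u → upper v u + upper u v)                 ≡⟨ ∑-cong V (λ v → ∑-+ V (upper v) (λ u → upper u v)) ⟩
    ∑ V (λ v → ∑ V (upper v) + ∑ V (λ u → upper u v))  ≡⟨ ∑-+ V _ _ ⟩
    ∑∑ upper + ∑∑ (λ v u → upper u v)                  ≡⟨ cong (λ s → ∑∑ upper + s) (∑-comm V V upper) ⟨
    ∑∑ upper + ∑∑ upper                                ≡⟨ double (∑∑ upper) ⟩
    + 2 * ∑∑ upper                                     ∎)
  where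
  open ≡-Reasoning
  V = allFin n
  ∑∑ : (Fin n → Fin n → ℤ) → ℤ
  ∑∑ K = ∑ V (λ v → ∑ V (K v))
  upper : Fin n → Fin n → ℤ
  upper v u = if ⌊ v Fin.<? u ⌋ then A v u else 0ℤ
  split : ∀ v u → A v u ≡ upper v u + upper u v
  split v u with v Fin.<? u | u Fin.<? v
  ... | yes v<u | yes u<v = ⊥-elim (Fin.<-asym v<u u<v)
  ... | yes _   | no _    = sym (ZP.+-identityʳ _)
  ... | no _    | yes _   = trans (A-sym v u) (sym (ZP.+-identityˡ _))
  ... | no v≮u  | no u≮v with Fin.≤-antisym (ℕ.≮⇒≥ u≮v) (ℕ.≮⇒≥ v≮u)
  ...   | refl = A-diag v
  double : ∀ q → q + q ≡ + 2 * q
  double = solve-∀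

twoOf : {A : Set} → (A → Bool) → List A → Bool
twoOf p []       = false
twoOf p (x ∷ xs) = (p x ∧ any p xs) ∨ twoOf p xs

module _ {A B : Set} (p : B → Bool) (f : A → B) where

  any-map⁺ : ∀ {u xs} → u ∈ xs → T (p (f u)) → T (any p (map f xs))
  any-map⁺ u∈xs pu = any⁺ p (map⁺ (lose u∈xs pu))

  twoOf-map⁺ : ∀ {u u′ xs} → u ∈ xs → u′ ∈ xs → u ≢ u′ → T (p (f u)) → T (p (f u′)) →
    T (twoOf p (map f xs))
  twoOf-map⁺ (here refl)  (here refl)   u≢u′ _  _   = ⊥-elim (u≢u′ refl)
  twoOf-map⁺ (here refl)  (there u′∈xs) _    pu pu′ = from T-∨ (inj₁ (from T-∧ (pu , any-map⁺ u′∈xs pu′)))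
  twoOf-map⁺ (there u∈xs) (here refl)   _    pu pu′ = from T-∨ (inj₁ (from T-∧ (pu′ , any-map⁺ u∈xs pu)))
  twoOf-map⁺ (there u∈xs) (there u′∈xs) u≢u′ pu pu′ = from T-∨ (inj₂ (twoOf-map⁺ u∈xs u′∈xs u≢u′ pu pu′))

module _ {n : ℕ} (G : Graph n) where

  adj⇒∈nbrs : ∀ {v u} → adj G v u ≡ true → u ∈ nbrs G v
  adj⇒∈nbrs {v} {u} vu = ∈-filter⁺ (T? ∘ adj G v) (∈-allFin u) (from T-≡ vu)

  ∑-nbrs : ∀ v (h : Fin n → ℤ) → ∑ (nbrs G v) h ≡ ∑ (allFin n) (λ u → if adj G v u then h u else 0ℤ)
  ∑-nbrs v = ∑-filterᵇ (adj G v) (allFin n)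

  ∑-nbrs-transpose : ∀ (K : Fin n → Fin n → ℤ) →
    ∑ (allFin n) (λ v → ∑ (nbrs G v) (K v)) ≡ ∑ (allFin n) (λ v → ∑ (nbrs G v) (λ u → K u v))
  ∑-nbrs-transpose K = begin
    ∑ V (λ v → ∑ (nbrs G v) (K v))                        ≡⟨ ∑-cong V (λ v → ∑-nbrs v (K v)) ⟩
    ∑ V (λ v → ∑ V (λ u → if adj G v u then K v u else 0ℤ)) ≡⟨ ∑-comm V V _ ⟩
    ∑ V (λ u → ∑ V (λ v → if adj G v u then K v u else 0ℤ)) ≡⟨ ∑-cong V (λ u → ∑-cong V (λ v →
                                                                 cong (if_then K v u else 0ℤ) (adj-sym G v u))) ⟩
    ∑ V (λ u → ∑ V (λ v → if adj G u v then K v u else 0ℤ)) ≡⟨ ∑-cong V (λ u → ∑-nbrs u (λ v → K v u)) ⟨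
    ∑ V (λ u → ∑ (nbrs G u) (λ v → K v u))                ∎
    where
    open ≡-Reasoning
    V = allFin n

  ∑-nbrs-even : ∀ (S : Fin n → Fin n → ℤ) → (∀ u v → S u v ≡ S v u) →
    ∃ λ Q → ∑ (allFin n) (λ v → ∑ (nbrs G v) (S v)) ≡ + 2 * Q
  ∑-nbrs-even S S-sym =
    let Q , even = ∑∑-even onEdges onEdges-sym onEdges-diag
    in  Q , trans (∑-cong (allFin n) (λ v → ∑-nbrs v (S v))) even
    where
    onEdges : Fin n → Fin n → ℤ
    onEdges v u = if adj G v u then S v u else 0ℤ
    onEdges-sym : ∀ u v → onEdges u v ≡ onEdges v u
    onEdges-sym u v = cong₂ (if_then_else 0ℤ) (adj-sym G u v) (S-sym u v)
    onEdges-diag : ∀ v → onEdges v v ≡ 0ℤ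
    onEdges-diag v = cong (if_then S v v else 0ℤ) (irrefl G v)

∀-Label? : {P : Label → Set} → (∀ x → Dec (P x)) → Dec (∀ x → P x)
∀-Label? P? with P? m1 | P? one | P? two | P? three
... | yes p₁ | yes p₂ | yes p₃ | yes p₄ = yes λ { m1 → p₁ ; one → p₂ ; two → p₃ ; three → p₄ }
... | no ¬p  | _      | _      | _      = no λ p → ¬p (p m1)
... | _      | no ¬p  | _      | _      = no λ p → ¬p (p one)
... | _      | _      | no ¬p  | _      = no λ p → ¬p (p two)
... | _      | _      | _      | no ¬p  = no λ p → ¬p (p three)

isTwo isThree isStrong : Label → Bool
isTwo two = true
isTwo _   = false
isThree three = true
isThree _     = false
isStrong y = isTwo y ∨ isThree y

defendedᵇ : Label → List Label → Bool
defendedᵇ m1    ys = any isThree ys ∨ twoOf isTwo ys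
defendedᵇ one   ys = any isStrong ys
defendedᵇ two   ys = true
defendedᵇ three ys = true

locallySDRᵇ : Label → List Label → Bool
locallySDRᵇ x ys = defendedᵇ x ys ∧ (+ 1 ≤ᵇ val x + ∑ ys val)

gift : Label → ℤ
gift m1    = 0ℤ
gift one   = + 1
gift two   = + 3
gift three = + 5

sends : Label → Label → ℤ
sends x m1 = gift x
sends x _  = 0ℤ

negative : Label → ℤ
negative m1 = + 1
negative _  = 0ℤ

charge : Label → List Label → ℤ
charge x ys = + 4 * val x + (∑ ys (λ y → sends y x) - ∑ ys (sends x))

negCount : List Label → ℤ
negCount ys = ∑ ys negative

negLoad : Label → List Label → ℤ
negLoad x ys = + 4 * (negative x * negCount ys) + negCount ys

StarBounds : Label → List Label → Set
StarBounds x ys = (+ 12 + + 3 * negative x ≤ + 5 * charge x ys + negLoad x ys)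
                × (negLoad x ys ≤ + 2 + + 3 * negative x)

-- Decided by evaluation on all 4⁴ labelled stars.
cubic-star-bounds : ∀ x y z u → T (locallySDRᵇ x (y ∷ z ∷ u ∷ [])) → StarBounds x (y ∷ z ∷ u ∷ [])
cubic-star-bounds = toWitness {a? = ∀-Label? λ x → ∀-Label? λ y → ∀-Label? λ z → ∀-Label? λ u →
  T? (locallySDRᵇ x (y ∷ z ∷ u ∷ [])) →-dec star-bounds? x (y ∷ z ∷ u ∷ [])} _
  where
  star-bounds? : ∀ x ys → Dec (StarBounds x ys)
  star-bounds? x ys = (_ ≤? _) ×-dec (_ ≤? _)

module Discharging {n : ℕ} (G : Graph n) (f : Fin n → Label) where

  V : List (Fin n)
  V = allFin n

  star : Fin n → List Label
  star v = map f (nbrs G v)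

  sdrdf⇒locallySDR : IsSDRDF G f → ∀ v → T (locallySDRᵇ (f v) (star v))
  sdrdf⇒locallySDR sdrdf v = from T-∧ (defended , ZP.≤⇒≤ᵇ closed)
    where
    open IsSDRDF sdrdf
    closed : + 1 ≤ val (f v) + ∑ (star v) val
    closed = subst (λ s → + 1 ≤ val (f v) + s) (sym (∑-map f (nbrs G v) val)) (cond3 v)
    defended : T (defendedᵇ (f v) (star v))
    defended with f v in fv
    ... | m1 with cond1 v fv
    ...   | inj₁ (u , vu , fu) =
            from T-∨ (inj₁ (any-map⁺ isThree f (adj⇒∈nbrs G vu) (subst (T ∘ isThree) (sym fu) _)))
    ...   | inj₂ (u , u′ , u≢u′ , vu , vu′ , fu , fu′) =
            from T-∨ (inj₂ (twoOf-map⁺ isTwo f (adj⇒∈nbrs G vu) (adj⇒∈nbrs G vu′) u≢u′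
              (subst (T ∘ isTwo) (sym fu) _) (subst (T ∘ isTwo) (sym fu′) _)))
    defended | one with cond2 v fv
    ...   | u , vu , fu = any-map⁺ isStrong f (adj⇒∈nbrs G vu) (strong fu)
      where
      strong : ∀ {y} → y ≡ two ⊎ y ≡ three → T (isStrong y)
      strong (inj₁ refl) = _
      strong (inj₂ refl) = _
    defended | two   = _
    defended | three = _

  star-bounds : Cubic G → IsSDRDF G f → ∀ v → StarBounds (f v) (star v)
  star-bounds cubic sdrdf v with star v | trans (List.length-map f (nbrs G v)) (cubic v) | sdrdf⇒locallySDR sdrdf v
  ... | y ∷ z ∷ u ∷ [] | refl | ok = cubic-star-bounds (f v) y z u ok

  negTotal : ℤ
  negTotal = ∑ V (negative ∘ f)

  ∑V-affine : ∀ (c d : ℤ) (g : Fin n → ℤ) → ∑ V (λ v → c + d * g v) ≡ c * + n + d * ∑ V g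
  ∑V-affine c d g = begin
    ∑ V (λ v → c + d * g v)              ≡⟨ ∑-+ V (λ _ → c) (λ v → d * g v) ⟩
    ∑ V (λ _ → c) + ∑ V (λ v → d * g v)  ≡⟨ cong₂ _+_ (∑-const V c) (∑-* V d g) ⟩
    c * + length V + d * ∑ V g           ≡⟨ cong (λ m → c * + m + d * ∑ V g) (List.length-tabulate (λ v → v)) ⟩
    c * + n + d * ∑ V g                  ∎
    where open ≡-Reasoning

  ∑-charge : ∑ V (λ v → charge (f v) (star v)) ≡ + 4 * weight f
  ∑-charge = begin
    ∑ V (λ v → charge (f v) (star v))                     ≡⟨ ∑-+ V (λ v → + 4 * val (f v)) (λ v → received v - sent v) ⟩
    ∑ V (λ v → + 4 * val (f v)) + ∑ V (λ v → received v - sent v)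
                                                          ≡⟨ cong₂ _+_ (∑-* V (+ 4) (val ∘ f)) (∑-- V received sent) ⟩
    + 4 * weight f + (∑ V received - ∑ V sent)            ≡⟨ cong (λ s → + 4 * weight f + (s - ∑ V sent)) received≡sent ⟩
    + 4 * weight f + (∑ V sent - ∑ V sent)                ≡⟨ cong (λ s → + 4 * weight f + s) (ZP.+-inverseʳ (∑ V sent)) ⟩
    + 4 * weight f + 0ℤ                                   ≡⟨ ZP.+-identityʳ _ ⟩
    + 4 * weight f                                        ∎
    where
    open ≡-Reasoning
    received sent : Fin n → ℤ
    received v = ∑ (star v) (λ y → sends y (f v))
    sent     v = ∑ (star v) (sends (f v))
    received≡sent : ∑ V received ≡ ∑ V sent
    received≡sent = begin
      ∑ V received                                        ≡⟨ ∑-cong V (λ v → ∑-map f (nbrs G v) _) ⟩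
      ∑ V (λ v → ∑ (nbrs G v) (λ u → sends (f u) (f v)))  ≡⟨ ∑-nbrs-transpose G (λ v u → sends (f u) (f v)) ⟩
      ∑ V (λ v → ∑ (nbrs G v) (λ u → sends (f v) (f u)))  ≡⟨ ∑-cong V (λ v → ∑-map f (nbrs G v) _) ⟨
      ∑ V sent                                            ∎

  ∑-negCount : Cubic G → ∑ V (λ v → negCount (star v)) ≡ + 3 * negTotal
  ∑-negCount cubic = begin
    ∑ V (λ v → negCount (star v))                    ≡⟨ ∑-cong V (λ v → ∑-map f (nbrs G v) negative) ⟩
    ∑ V (λ v → ∑ (nbrs G v) (λ u → negative (f u)))  ≡⟨ ∑-nbrs-transpose G (λ v u → negative (f u)) ⟩
    ∑ V (λ v → ∑ (nbrs G v) (λ _ → negative (f v)))  ≡⟨ ∑-cong V degree-times ⟩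
    ∑ V (λ v → + 3 * negative (f v))                 ≡⟨ ∑-* V (+ 3) (negative ∘ f) ⟩
    + 3 * negTotal                                   ∎
    where
    open ≡-Reasoning
    degree-times : ∀ v → ∑ (nbrs G v) (λ _ → negative (f v)) ≡ + 3 * negative (f v)
    degree-times v = begin
      ∑ (nbrs G v) (λ _ → negative (f v))  ≡⟨ ∑-const (nbrs G v) (negative (f v)) ⟩
      negative (f v) * + degree G v        ≡⟨ cong (λ d → negative (f v) * + d) (cubic v) ⟩
      negative (f v) * + 3                 ≡⟨ ZP.*-comm (negative (f v)) (+ 3) ⟩
      + 3 * negative (f v)                 ∎

  ∑-negPairs : ∃ λ Q → ∑ V (λ v → negative (f v) * negCount (star v)) ≡ + 2 * Q
  ∑-negPairs with ∑-nbrs-even G (λ v u → negative (f v) * negative (f u)) (λ u v → ZP.*-comm (negative (f u)) _)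
  ... | Q , even = Q , trans (∑-cong V pairs) even
    where
    pairs : ∀ v → negative (f v) * negCount (star v) ≡ ∑ (nbrs G v) (λ u → negative (f v) * negative (f u))
    pairs v = trans (cong (negative (f v) *_) (∑-map f (nbrs G v) negative))
                    (sym (∑-* (nbrs G v) (negative (f v)) (negative ∘ f)))

  ∑-negLoad : Cubic G → ∃ λ Q → ∑ V (λ v → negLoad (f v) (star v)) ≡ + 8 * Q + + 3 * negTotal
  ∑-negLoad cubic with ∑-negPairs
  ... | Q , pairs = Q , (begin
    ∑ V (λ v → negLoad (f v) (star v))
      ≡⟨ ∑-+ V (λ v → + 4 * (negative (f v) * negCount (star v))) (λ v → negCount (star v)) ⟩
    ∑ V (λ v → + 4 * (negative (f v) * negCount (star v))) + ∑ V (λ v → negCount (star v))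
      ≡⟨ cong₂ _+_ (trans (∑-* V (+ 4) _) (cong (λ s → + 4 * s) pairs)) (∑-negCount cubic) ⟩
    + 4 * (+ 2 * Q) + + 3 * negTotal
      ≡⟨ cong (λ s → s + + 3 * negTotal) (ZP.*-assoc (+ 4) (+ 2) Q) ⟨
    + 8 * Q + + 3 * negTotal ∎)
    where open ≡-Reasoning

  discharging : Cubic G → IsSDRDF G f →
    ∃ λ Q → (+ 12 * + n ≤ + 20 * weight f + + 8 * Q) × (+ 8 * Q ≤ + 2 * + n)
  discharging cubic sdrdf with ∑-negLoad cubic
  ... | Q , load = Q , +-cancelʳ-≤ (+ 3 * negTotal) lower , +-cancelʳ-≤ (+ 3 * negTotal) upper
    where
    open ZP.≤-Reasoning
    bounds : ∀ v → StarBounds (f v) (star v)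
    bounds = star-bounds cubic sdrdf
    lower : + 12 * + n + + 3 * negTotal ≤ + 20 * weight f + + 8 * Q + + 3 * negTotal
    lower = begin
      + 12 * + n + + 3 * negTotal
        ≡⟨ ∑V-affine (+ 12) (+ 3) (negative ∘ f) ⟨
      ∑ V (λ v → + 12 + + 3 * negative (f v))
        ≤⟨ ∑-mono-≤ V (proj₁ ∘ bounds) ⟩
      ∑ V (λ v → + 5 * charge (f v) (star v) + negLoad (f v) (star v))
        ≡⟨ ∑-+ V (λ v → + 5 * charge (f v) (star v)) (λ v → negLoad (f v) (star v)) ⟩
      ∑ V (λ v → + 5 * charge (f v) (star v)) + ∑ V (λ v → negLoad (f v) (star v))
        ≡⟨ cong₂ _+_ (trans (∑-* V (+ 5) _) (cong (λ s → + 5 * s) ∑-charge)) load ⟩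
      + 5 * (+ 4 * weight f) + (+ 8 * Q + + 3 * negTotal)
        ≡⟨ regroup (weight f) Q negTotal ⟩
      + 20 * weight f + + 8 * Q + + 3 * negTotal ∎
      where
      regroup : ∀ w q m → + 5 * (+ 4 * w) + (+ 8 * q + + 3 * m) ≡ + 20 * w + + 8 * q + + 3 * m
      regroup = solve-∀
    upper : + 8 * Q + + 3 * negTotal ≤ + 2 * + n + + 3 * negTotal
    upper = begin
      + 8 * Q + + 3 * negTotal                ≡⟨ load ⟨
      ∑ V (λ v → negLoad (f v) (star v))      ≤⟨ ∑-mono-≤ V (proj₂ ∘ bounds) ⟩
      ∑ V (λ v → + 2 + + 3 * negative (f v))  ≡⟨ ∑V-affine (+ 2) (+ 3) (negative ∘ f) ⟩
      + 2 * + n + + 3 * negTotal              ∎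

theorem3 : ∀ (n : ℕ) (G : Graph n) → Cubic G →
    ∀ (f : Fin n → Label) → IsSDRDF G f →
      (n % 4 ≡ 0 → + (n / 2) ≤ weight f)
      × (n % 4 ≡ 2 → + (n / 2) + + 1 ≤ weight f)
theorem3 n G cubic f sdrdf with Discharging.discharging G f cubic sdrdf
... | Q , lower , upper = half-bound n (weight f) Q lower upper
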